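{- Let $t\in\mathbb{N}$ and let $n\geq 2(t+3)-\left\lceil\frac{t+2}{2}\right\rceil$ (with $n\geq 5$). If $k=\binom{n-2}{2}-t$, then $\gamma_{\times k}(K(n,2))=k+2n-4$.
   Context: The Kneser graph $K(n,2)$ has as vertices the $2$-subsets of $[n]=\{1,\dots,n\}$, two vertices adjacent iff disjoint. For a vertex $v$, $N[v]$ is its closed neighbourhood. A set $D$ of vertices is a $k$-tuple dominating set if $|N[v]\cap D|\geq k$ for every vertex $v$; $\gamma_{\times k}(K(n,2))$ is the minimum cardinality of such a set. -}

module Defs where

open import Data.Nat using (ℕ; _≤_)
open import Data.Fin using (Fin; _<_)
import Data.Fin as F
open import Data.Bool using (Bool; _∧_; _∨_; not)
open import Data.Product using (_×_; _,_; proj₁; proj₂; Σ; ∃)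
open import Data.List using (List; length; filterᵇ)
open import Data.List.Relation.Unary.All using (All)
open import Data.List.Relation.Unary.Unique.Propositional using (Unique)
open import Relation.Nullary.Decidable using (⌊_⌋)
open import Relation.Binary.PropositionalEquality using (_≡_)

-- A vertex of K(n,2) is a 2-subset {i,j} of [n], encoded canonically as a
-- pair (i , j) of elements of Fin n with i < j.
Pair : ℕ → Set
Pair n = Fin n × Fin n

IsVertex : {n : ℕ} → Pair n → Set
IsVertex (i , j) = i < j

_=ᶠ_ : {n : ℕ} → Fin n → Fin n → Bool
a =ᶠ b = ⌊ a F.≟ b ⌋

sameᵇ : {n : ℕ} → Pair n → Pair n → Bool
sameᵇ (a , b) (c , d) = (a =ᶠ c) ∧ (b =ᶠ d)

disjointᵇ : {n : ℕ} → Pair n → Pair n → Bool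
disjointᵇ (a , b) (c , d) =
  not (a =ᶠ c) ∧ not (a =ᶠ d) ∧ not (b =ᶠ c) ∧ not (b =ᶠ d)

inClosedNbhᵇ : {n : ℕ} → Pair n → Pair n → Bool
inClosedNbhᵇ v u = sameᵇ u v ∨ disjointᵇ u v

IsVertexSet : (n : ℕ) → List (Pair n) → Set
IsVertexSet n D = All IsVertex D × Unique D

closedNbhCount : {n : ℕ} → Pair n → List (Pair n) → ℕ
closedNbhCount v D = length (filterᵇ (inClosedNbhᵇ v) D)

IsKTupleDominating : (n k : ℕ) → List (Pair n) → Set
IsKTupleDominating n k D =
  IsVertexSet n D × ((v : Pair n) → IsVertex v → k ≤ closedNbhCount v D)

KTupleDominationNumber : (n k m : ℕ) → Set
KTupleDominationNumber n k m =
  (Σ (List (Pair n)) λ D → IsKTupleDominating n k D × length D ≡ m)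
  × ((D : List (Pair n)) → IsKTupleDominating n k D → m ≤ length D)

{-# OPTIONS --safe #-}
module Submission where

-- Every closed neighbourhood of K(n,2) has C(n-2,2) + 1 = k + t + 1 of the C(n,2) vertices, so
-- deleting any t + 1 vertices leaves a k-tuple dominating set of size C(n,2) - t - 1 = k + 2n - 4.
-- Conversely, suppose a k-tuple dominating set D misses t + 2 vertices S. Read S as a graph with t + 2
-- edges on [n]. As 3(t+2) + 3 ≤ 2n, either two points of [n] are untouched by S, or some edge of S
-- meets no other edge of S (by a weight-counting argument); the pair of points, resp. that edge, is
-- a vertex v with S ⊆ N[v], and then N[v] contains at most k - 1 vertices of D.

open import Defs
open import Data.Nat using (ℕ; zero; suc; _+_; _*_; _∸_; _≤_; _<_; z≤n; s≤s; ⌈_/2⌉; _≤?_; _<ᵇ_; _≟_)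
open import Data.Nat.Properties
open import Data.Nat.Combinatorics using (_C_; nCk+nC[k+1]≡[n+1]C[k+1]; nC1≡n)
open import Data.Nat.ListAction using (sum)
open import Data.Nat.Tactic.RingSolver using (solve-∀)
open import Algebra.Properties.Semiring.Sum +-*-semiring
  using (sum-syntax; ∑-distrib-+; sum-cong-≗; *-distribˡ-sum; sum-replicate-zero)
open import Data.Fin as F using (Fin; zero; suc)
import Data.Fin.Properties as FP
open import Data.Bool using (Bool; true; false; _∧_; _∨_; not)
open import Data.Bool.Properties using (∨-zeroʳ; T-≡)
open import Data.Product using (_×_; _,_; proj₁; proj₂; ∃-syntax)
import Data.Product as Product
open import Data.Product.Properties using (≡-dec; ,-injectiveʳ)
open import Data.Sum using (_⊎_; inj₁; inj₂)
open import Data.Empty using (⊥; ⊥-elim)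
open import Data.List using (List; []; _∷_; length; filter; filterᵇ; map; _++_; take; drop; tabulate)
open import Data.List.Properties using (length-++; length-take; length-drop)
open import Data.List.Membership.Propositional using (_∈_; find)
open import Data.List.Membership.Propositional.Properties
  using (∈-map⁺; ∈-map⁻; ∈-++⁺ˡ; ∈-++⁺ʳ; ∈-++⁻; ∈-∃++; ∈-filter⁺; ∈-filter⁻; ∈-tabulate⁺; ∈-tabulate⁻)
import Data.List.Membership.DecPropositional as DecMembership
open import Data.List.Relation.Binary.Subset.Propositional using (_⊆_)
open import Data.List.Relation.Binary.Disjoint.Propositional using (Disjoint)
open import Data.List.Relation.Unary.Any using (here; there; any?)
open import Data.List.Relation.Unary.All as All using (All; []; _∷_)
import Data.List.Relation.Unary.All.Properties as AllP
open import Data.List.Relation.Unary.AllPairs using ([]; _∷_)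
open import Data.List.Relation.Unary.Unique.Propositional using (Unique)
import Data.List.Relation.Unary.Unique.Propositional.Properties as UniqueP
open import Function using (_∘_; Equivalence)
open import Relation.Binary.Definitions using (DecidableEquality)
open import Relation.Binary.PropositionalEquality
open import Relation.Nullary using (¬_; Dec; yes; no)
open import Relation.Nullary.Decidable using (_×-dec_; T?; isYes≗does; dec-true; dec-false; ⌊⌋-map′)

private variable
  A : Set
  n : ℕ

𝟙 : Bool → ℕ
𝟙 true = 1
𝟙 false = 0

count : (A → Bool) → List A → ℕ
count p [] = 0
count p (x ∷ xs) = 𝟙 (p x) + count p xs

length-filterᵇ : (p : A → Bool) (xs : List A) → length (filterᵇ p xs) ≡ count p xs
length-filterᵇ p [] = refl
length-filterᵇ p (x ∷ xs) with p x
... | true = cong suc (length-filterᵇ p xs)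
... | false = length-filterᵇ p xs

count-cong : {p q : A → Bool} → (∀ x → p x ≡ q x) → (xs : List A) → count p xs ≡ count q xs
count-cong p≗q [] = refl
count-cong p≗q (x ∷ xs) = cong₂ _+_ (cong 𝟙 (p≗q x)) (count-cong p≗q xs)

count-∨ : (p q : A → Bool) → (∀ x → p x ∧ q x ≡ false) → (xs : List A) →
  count (λ x → p x ∨ q x) xs ≡ count p xs + count q xs
count-∨ p q exclusive [] = refl
count-∨ p q exclusive (x ∷ xs) with p x | q x | exclusive x
... | true | false | _ = cong suc (count-∨ p q exclusive xs)
... | false | true | _ = trans (cong suc (count-∨ p q exclusive xs)) (sym (+-suc _ _))
... | false | false | _ = count-∨ p q exclusive xs

count-++ : (p : A → Bool) (xs ys : List A) → count p (xs ++ ys) ≡ count p xs + count p ys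
count-++ p [] ys = refl
count-++ p (x ∷ xs) ys = trans (cong (𝟙 (p x) +_) (count-++ p xs ys)) (sym (+-assoc (𝟙 (p x)) _ _))

count-map : {B : Set} (p : B → Bool) (f : A → B) (xs : List A) → count p (map f xs) ≡ count (p ∘ f) xs
count-map p f [] = refl
count-map p f (x ∷ xs) = cong (𝟙 (p (f x)) +_) (count-map p f xs)

count-true : (xs : List A) → count (λ _ → true) xs ≡ length xs
count-true [] = refl
count-true (x ∷ xs) = cong suc (count-true xs)

count-tabulate : (p : A → Bool) (f : Fin n → A) → count p (tabulate f) ≡ ∑[ i < n ] 𝟙 (p (f i))
count-tabulate {n = zero} p f = refl
count-tabulate {n = suc n} p f = cong (𝟙 (p (f zero)) +_) (count-tabulate p (f ∘ suc))

count-≤-drop : (p : A → Bool) (r : ℕ) (xs : List A) → count p xs ≤ r + count p (drop r xs)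
count-≤-drop p zero xs = ≤-refl
count-≤-drop p (suc r) [] = z≤n
count-≤-drop p (suc r) (x ∷ xs) = +-mono-≤ (𝟙≤1 (p x)) (count-≤-drop p r xs)
  where
  𝟙≤1 : ∀ b → 𝟙 b ≤ 1
  𝟙≤1 true = ≤-refl
  𝟙≤1 false = z≤n

1≤count : (p : A → Bool) {x : A} {xs : List A} → x ∈ xs → p x ≡ true → 1 ≤ count p xs
1≤count p (here refl) px rewrite px = s≤s z≤n
1≤count p {xs = y ∷ xs} (there x∈xs) px = ≤-trans (1≤count p x∈xs px) (m≤n+m _ (𝟙 (p y)))

count≡0⇒false : (p : A → Bool) {x : A} {xs : List A} → count p xs ≡ 0 → x ∈ xs → p x ≡ false
count≡0⇒false p {x} count≡0 x∈xs with p x in px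
... | false = refl
... | true with () ← subst (1 ≤_) count≡0 (1≤count p x∈xs px)

2≤count : (p : A → Bool) {x y : A} {xs : List A} → Unique xs → x ∈ xs → y ∈ xs → x ≢ y →
  p x ≡ true → p y ≡ true → 2 ≤ count p xs
2≤count p _ (here refl) (here refl) x≢y _ _ = ⊥-elim (x≢y refl)
2≤count p _ (here refl) (there y∈xs) _ px py rewrite px = s≤s (1≤count p y∈xs py)
2≤count p _ (there x∈xs) (here refl) _ px py rewrite py = s≤s (1≤count p x∈xs px)
2≤count p {xs = z ∷ xs} (_ ∷ u) (there x∈xs) (there y∈xs) x≢y px py =
  ≤-trans (2≤count p u x∈xs y∈xs x≢y px py) (m≤n+m _ (𝟙 (p z)))

count-singleton : (p : A → Bool) {v : A} {xs : List A} → (∀ u → p u ≡ true → u ≡ v) →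
  p v ≡ true → Unique xs → v ∈ xs → count p xs ≡ 1
count-singleton p {v} only-v pv (v∉xs ∷ u) (here refl) rewrite pv = cong suc (count-none v∉xs)
  where
  count-none : ∀ {ys} → All (v ≢_) ys → count p ys ≡ 0
  count-none [] = refl
  count-none {y ∷ _} (v≢y ∷ v∉ys) with p y in py
  ... | true = ⊥-elim (v≢y (sym (only-v y py)))
  ... | false = count-none v∉ys
count-singleton p {xs = x ∷ _} only-v pv (x∉xs ∷ u) (there v∈xs) with p x in px
... | false = count-singleton p only-v pv u v∈xs
... | true = ⊥-elim (All.lookup x∉xs v∈xs (only-v x px))

take-⊆ : (m : ℕ) (xs : List A) → take m xs ⊆ xs
take-⊆ (suc m) (x ∷ xs) (here x≡y) = here x≡y
take-⊆ (suc m) (x ∷ xs) (there y∈xs) = there (take-⊆ m xs y∈xs)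

length-≤-⊆ : {xs ys : List A} → Unique xs → xs ⊆ ys → length xs ≤ length ys
length-≤-⊆ {xs = []} _ _ = z≤n
length-≤-⊆ {xs = x ∷ xs} {ys} (x∉xs ∷ u) x∷xs⊆ys with ∈-∃++ (x∷xs⊆ys (here refl))
... | (ys₁ , ys₂ , refl) = begin
    suc (length xs)                ≤⟨ s≤s (length-≤-⊆ u xs⊆ys₁++ys₂) ⟩
    suc (length (ys₁ ++ ys₂))      ≡⟨ cong suc (length-++ ys₁) ⟩
    suc (length ys₁ + length ys₂)  ≡⟨ +-suc (length ys₁) (length ys₂) ⟨
    length ys₁ + suc (length ys₂)  ≡⟨ length-++ ys₁ ⟨
    length (ys₁ ++ x ∷ ys₂)        ∎
  where
  open ≤-Reasoning
  xs⊆ys₁++ys₂ : xs ⊆ ys₁ ++ ys₂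
  xs⊆ys₁++ys₂ {z} z∈xs with ∈-++⁻ ys₁ (x∷xs⊆ys (there z∈xs))
  ... | inj₁ z∈ys₁ = ∈-++⁺ˡ z∈ys₁
  ... | inj₂ (here refl) = ⊥-elim (All.lookup x∉xs z∈xs refl)
  ... | inj₂ (there z∈ys₂) = ∈-++⁺ʳ ys₁ z∈ys₂

module _ (_≟ᴬ_ : DecidableEquality A) where
  open DecMembership _≟ᴬ_ using (_∈?_; _∉?_)

  length-≤-+-complement : (D : List A) {V : List A} → Unique V → length V ≤ length D + length (filter (_∉? D) V)
  length-≤-+-complement D {V} V-unique = begin
    length V                              ≤⟨ length-≤-⊆ V-unique V⊆D++rest ⟩
    length (D ++ filter (_∉? D) V)        ≡⟨ length-++ D ⟩
    length D + length (filter (_∉? D) V)  ∎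
    where
    open ≤-Reasoning
    V⊆D++rest : V ⊆ D ++ filter (_∉? D) V
    V⊆D++rest {u} u∈V with u ∈? D
    ... | yes u∈D = ∈-++⁺ˡ u∈D
    ... | no u∉D = ∈-++⁺ʳ D (∈-filter⁺ (_∉? D) u∈V u∉D)

count+length-≤ : (p : A → Bool) {D S V : List A} → Unique D → Unique S → Disjoint D S →
  D ⊆ V → S ⊆ V → All (λ u → p u ≡ true) S → count p D + length S ≤ count p V
count+length-≤ p {D} {S} {V} D-unique S-unique D∩S=∅ D⊆V S⊆V pS = begin
  count p D + length S               ≡⟨ cong (_+ length S) (length-filterᵇ p D) ⟨
  length (filterᵇ p D) + length S    ≡⟨ length-++ (filterᵇ p D) ⟨
  length (filterᵇ p D ++ S)          ≤⟨ length-≤-⊆ unique ⊆filterᵇ ⟩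
  length (filterᵇ p V)               ≡⟨ length-filterᵇ p V ⟩
  count p V                          ∎
  where
  open ≤-Reasoning
  unique : Unique (filterᵇ p D ++ S)
  unique = UniqueP.++⁺ (UniqueP.filter⁺ (T? ∘ p) D-unique) S-unique
             λ (u∈pD , u∈S) → D∩S=∅ (proj₁ (∈-filter⁻ (T? ∘ p) u∈pD) , u∈S)
  ⊆filterᵇ : filterᵇ p D ++ S ⊆ filterᵇ p V
  ⊆filterᵇ {u} u∈ with ∈-++⁻ (filterᵇ p D) u∈
  ... | inj₁ u∈pD = let u∈D , pu = ∈-filter⁻ (T? ∘ p) u∈pD in ∈-filter⁺ (T? ∘ p) (D⊆V u∈D) pu
  ... | inj₂ u∈S = ∈-filter⁺ (T? ∘ p) (S⊆V u∈S) (Equivalence.from T-≡ (All.lookup pS u∈S))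

∑-mono-≤ : {f g : Fin n → ℕ} → (∀ i → f i ≤ g i) → ∑[ i < n ] f i ≤ ∑[ i < n ] g i
∑-mono-≤ {n = zero} f≤g = z≤n
∑-mono-≤ {n = suc n} f≤g = +-mono-≤ (f≤g zero) (∑-mono-≤ (f≤g ∘ suc))

∑-const-1 : ∑[ i < n ] 1 ≡ n
∑-const-1 {n = zero} = refl
∑-const-1 {n = suc n} = cong suc ∑-const-1

sum-map-≤ : (g : A → ℕ) {c : ℕ} (xs : List A) → All (λ x → g x ≤ c) xs → sum (map g xs) ≤ c * length xs
sum-map-≤ g {c} [] [] = ≤-reflexive (sym (*-zeroʳ c))
sum-map-≤ g {c} (x ∷ xs) (gx≤c ∷ gxs≤c) =
  ≤-trans (+-mono-≤ gx≤c (sum-map-≤ g xs gxs≤c)) (≤-reflexive (sym (*-suc c (length xs))))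

=ᶠ-refl : (a : Fin n) → (a =ᶠ a) ≡ true
=ᶠ-refl a = trans (isYes≗does (a F.≟ a)) (dec-true (a F.≟ a) refl)

=ᶠ-≢ : {a b : Fin n} → a ≢ b → (a =ᶠ b) ≡ false
=ᶠ-≢ {a = a} {b} a≢b = trans (isYes≗does (a F.≟ b)) (dec-false (a F.≟ b) a≢b)

=ᶠ-suc : (a b : Fin n) → (suc a =ᶠ suc b) ≡ (a =ᶠ b)
=ᶠ-suc a b = ⌊⌋-map′ (cong suc) FP.suc-injective (a F.≟ b)

=ᶠ-true : {a b : Fin n} → (a =ᶠ b) ≡ true → a ≡ b
=ᶠ-true {a = a} {b} a=b with a F.≟ b
... | yes a≡b = a≡b

∑-delta : (i : Fin n) (f : Fin n → ℕ) → ∑[ x < n ] (𝟙 (x =ᶠ i) * f x) ≡ f i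
∑-delta {n = suc n} zero f =
  trans (cong (f zero + 0 +_) (sum-replicate-zero n)) (trans (+-identityʳ _) (+-identityʳ _))
∑-delta {n = suc n} (suc i) f =
  trans (sum-cong-≗ (λ x → cong (λ b → 𝟙 b * f (suc x)) (=ᶠ-suc x i))) (∑-delta i (f ∘ suc))

∑-complement : (p : Fin n → Bool) → ∑[ x < n ] 𝟙 (not (p x)) + ∑[ x < n ] 𝟙 (p x) ≡ n
∑-complement {n} p = begin
  ∑[ x < n ] 𝟙 (not (p x)) + ∑[ x < n ] 𝟙 (p x) ≡⟨ ∑-distrib-+ (𝟙 ∘ not ∘ p) (𝟙 ∘ p) ⟨
  ∑[ x < n ] (𝟙 (not (p x)) + 𝟙 (p x))          ≡⟨ sum-cong-≗ (λ x → 𝟙-not+𝟙 (p x)) ⟩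
  ∑[ x < n ] 1                                    ≡⟨ ∑-const-1 ⟩
  n                                               ∎
  where
  open ≡-Reasoning
  𝟙-not+𝟙 : ∀ b → 𝟙 (not b) + 𝟙 b ≡ 1
  𝟙-not+𝟙 true = refl
  𝟙-not+𝟙 false = refl

-- The Kneser graph K(n,2)

-- A vertex {a, b} of K(n,2) is also read as an edge of the complete graph on [n], with endpoints a and b.
_∈ₑ_ : Fin n → Pair n → Set
x ∈ₑ (a , b) = x ≡ a ⊎ x ≡ b

incidentᵇ : Fin n → Pair n → Bool
incidentᵇ x (a , b) = (x =ᶠ a) ∨ (x =ᶠ b)

∈ₑ⇒incidentᵇ : {x : Fin n} (e : Pair n) → x ∈ₑ e → incidentᵇ x e ≡ true
∈ₑ⇒incidentᵇ {x = x} (a , b) (inj₁ refl) rewrite =ᶠ-refl x = refl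
∈ₑ⇒incidentᵇ {x = x} (a , b) (inj₂ refl) rewrite =ᶠ-refl x = ∨-zeroʳ (x =ᶠ a)

∑-incident : {i j : Fin n} → IsVertex (i , j) → (f : Fin n → ℕ) →
  ∑[ x < n ] (𝟙 (incidentᵇ x (i , j)) * f x) ≡ f i + f j
∑-incident {n} {i} {j} i<j f = begin
  ∑[ x < n ] (𝟙 ((x =ᶠ i) ∨ (x =ᶠ j)) * f x)                   ≡⟨ sum-cong-≗ split ⟩
  ∑[ x < n ] (𝟙 (x =ᶠ i) * f x + 𝟙 (x =ᶠ j) * f x)             ≡⟨ ∑-distrib-+ (λ x → 𝟙 (x =ᶠ i) * f x) (λ x → 𝟙 (x =ᶠ j) * f x) ⟩
  ∑[ x < n ] (𝟙 (x =ᶠ i) * f x) + ∑[ x < n ] (𝟙 (x =ᶠ j) * f x) ≡⟨ cong₂ _+_ (∑-delta i f) (∑-delta j f) ⟩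
  f i + f j                                                     ∎
  where
  open ≡-Reasoning
  split : ∀ x → 𝟙 ((x =ᶠ i) ∨ (x =ᶠ j)) * f x ≡ 𝟙 (x =ᶠ i) * f x + 𝟙 (x =ᶠ j) * f x
  split x with x =ᶠ i in x=i | x =ᶠ j in x=j
  ... | true | true = ⊥-elim (FP.<-irrefl (trans (sym (=ᶠ-true x=i)) (=ᶠ-true x=j)) i<j)
  ... | true | false = sym (+-identityʳ _)
  ... | false | _ = refl

disjointᵇ-intro : {u v : Pair n} → (∀ {x} → x ∈ₑ u → x ∈ₑ v → ⊥) → disjointᵇ u v ≡ true
disjointᵇ-intro {u = a , b} {c , d} no-common
  rewrite =ᶠ-≢ (λ a≡c → no-common (inj₁ refl) (inj₁ a≡c))
        | =ᶠ-≢ (λ a≡d → no-common (inj₁ refl) (inj₂ a≡d))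
        | =ᶠ-≢ (λ b≡c → no-common (inj₂ refl) (inj₁ b≡c))
        | =ᶠ-≢ (λ b≡d → no-common (inj₂ refl) (inj₂ b≡d)) = refl

disjointᵇ-endpoints : (u v : Pair n) → disjointᵇ u v ≡ not (incidentᵇ (proj₁ u) v) ∧ not (incidentᵇ (proj₂ u) v)
disjointᵇ-endpoints (a , b) (c , d) with a =ᶠ c | a =ᶠ d
... | true | _ = refl
... | false | true = refl
... | false | false with b =ᶠ c
...   | true = refl
...   | false = refl

sameᵇ-refl : (v : Pair n) → sameᵇ v v ≡ true
sameᵇ-refl (a , b) rewrite =ᶠ-refl a | =ᶠ-refl b = refl

sameᵇ-true : (u v : Pair n) → sameᵇ u v ≡ true → u ≡ v
sameᵇ-true (a , b) (c , d) same with a =ᶠ c in a=c | b =ᶠ d in b=d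
... | true | true = cong₂ _,_ (=ᶠ-true a=c) (=ᶠ-true b=d)

sameᵇ∧disjointᵇ : (u v : Pair n) → sameᵇ u v ∧ disjointᵇ u v ≡ false
sameᵇ∧disjointᵇ (a , b) (c , d) with a =ᶠ c | b =ᶠ d
... | true | true = refl
... | true | false = refl
... | false | _ = refl

inClosedNbhᵇ-self : (v : Pair n) → inClosedNbhᵇ v v ≡ true
inClosedNbhᵇ-self v rewrite sameᵇ-refl v = refl

inClosedNbhᵇ-disjoint : (u : Pair n) {v : Pair n} → disjointᵇ u v ≡ true → inClosedNbhᵇ v u ≡ true
inClosedNbhᵇ-disjoint u {v} u∩v=∅ rewrite u∩v=∅ = ∨-zeroʳ (sameᵇ u v)

C2-suc : (m : ℕ) → suc m C 2 ≡ m + m C 2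
C2-suc m = trans (sym (nCk+nC[k+1]≡[n+1]C[k+1] m 1)) (cong (_+ m C 2) (nC1≡n m))

vertices : (n : ℕ) → List (Pair n)
vertices zero = []
vertices (suc n) = tabulate (λ j → zero , suc j) ++ map (Product.map suc suc) (vertices n)

∈-vertices : (v : Pair n) → IsVertex v → v ∈ vertices n
∈-vertices {suc n} (zero , suc j) _ = ∈-++⁺ˡ (∈-tabulate⁺ j)
∈-vertices {suc n} (suc i , suc j) (s≤s i<j) = ∈-++⁺ʳ _ (∈-map⁺ (Product.map suc suc) (∈-vertices (i , j) i<j))

vertices-IsVertex : (n : ℕ) → All IsVertex (vertices n)
vertices-IsVertex zero = []
vertices-IsVertex (suc n) = AllP.++⁺ (AllP.tabulate⁺ (λ _ → s≤s z≤n))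
                                     (AllP.map⁺ (All.map s≤s (vertices-IsVertex n)))

vertices-unique : (n : ℕ) → Unique (vertices n)
vertices-unique zero = []
vertices-unique (suc n) =
  UniqueP.++⁺ (UniqueP.tabulate⁺ (FP.suc-injective ∘ ,-injectiveʳ))
              (UniqueP.map⁺ suc×suc-injective (vertices-unique n))
              first-row∩rest=∅
  where
  suc×suc-injective : {u v : Pair n} → Product.map suc suc u ≡ Product.map suc suc v → u ≡ v
  suc×suc-injective eq = cong₂ _,_ (FP.suc-injective (cong proj₁ eq)) (FP.suc-injective (cong proj₂ eq))
  first-row∩rest=∅ : Disjoint (tabulate (λ j → zero , suc j)) (map (Product.map suc suc) (vertices n))
  first-row∩rest=∅ (in-row , in-rest) with ∈-tabulate⁻ {f = λ j → zero , suc j} in-row | ∈-map⁻ (Product.map suc suc) in-rest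
  ... | _ , refl | _ , _ , ()

count-vertices-inside : (q : Fin n → Bool) →
  count (λ u → q (proj₁ u) ∧ q (proj₂ u)) (vertices n) ≡ (∑[ x < n ] 𝟙 (q x)) C 2
count-vertices-inside {zero} q = refl
count-vertices-inside {suc n} q = begin
  count inside (tabulate (λ j → zero , suc j) ++ map (Product.map suc suc) (vertices n))
    ≡⟨ count-++ inside (tabulate (λ j → zero , suc j)) _ ⟩
  count inside (tabulate (λ j → zero , suc j)) + count inside (map (Product.map suc suc) (vertices n))
    ≡⟨ cong₂ _+_ (count-tabulate inside (λ j → zero , suc j))
                 (trans (count-map inside (Product.map suc suc) (vertices n)) (count-vertices-inside (q ∘ suc))) ⟩
  ∑[ j < n ] 𝟙 (q zero ∧ q (suc j)) + m C 2
    ≡⟨ first-row (q zero) ⟩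
  (𝟙 (q zero) + m) C 2
    ∎
  where
  open ≡-Reasoning
  inside : Pair (suc n) → Bool
  inside u = q (proj₁ u) ∧ q (proj₂ u)
  m = ∑[ j < n ] 𝟙 (q (suc j))
  first-row : ∀ b → ∑[ j < n ] 𝟙 (b ∧ q (suc j)) + m C 2 ≡ (𝟙 b + m) C 2
  first-row true = sym (C2-suc m)
  first-row false = cong (_+ m C 2) (sum-replicate-zero n)

length-vertices : (n : ℕ) → length (vertices n) ≡ n C 2
length-vertices n = begin
  length (vertices n)              ≡⟨ count-true (vertices n) ⟨
  count (λ _ → true) (vertices n)  ≡⟨ count-vertices-inside {n} (λ _ → true) ⟩
  (∑[ x < n ] 1) C 2               ≡⟨ cong (_C 2) (∑-const-1 {n}) ⟩
  n C 2                            ∎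
  where open ≡-Reasoning

closedNbh-size : (v : Pair n) → IsVertex v → count (inClosedNbhᵇ v) (vertices n) ≡ suc ((n ∸ 2) C 2)
closedNbh-size {n} v@(i , j) i<j = begin
  count (λ u → sameᵇ u v ∨ disjointᵇ u v) (vertices n)
    ≡⟨ count-∨ (λ u → sameᵇ u v) (λ u → disjointᵇ u v) (λ u → sameᵇ∧disjointᵇ u v) (vertices n) ⟩
  count (λ u → sameᵇ u v) (vertices n) + count (λ u → disjointᵇ u v) (vertices n)
    ≡⟨ cong₂ _+_ (count-singleton _ (λ u → sameᵇ-true u v) (sameᵇ-refl v) (vertices-unique n) (∈-vertices v i<j))
                 (count-cong (λ u → disjointᵇ-endpoints u v) (vertices n)) ⟩
  suc (count (λ u → avoid (proj₁ u) ∧ avoid (proj₂ u)) (vertices n))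
    ≡⟨ cong suc (count-vertices-inside avoid) ⟩
  suc ((∑[ x < n ] 𝟙 (avoid x)) C 2)
    ≡⟨ cong (λ m → suc (m C 2)) |avoid|≡n∸2 ⟩
  suc ((n ∸ 2) C 2)
    ∎
  where
  open ≡-Reasoning
  avoid : Fin n → Bool
  avoid x = not (incidentᵇ x v)
  |v|≡2 : ∑[ x < n ] 𝟙 (incidentᵇ x v) ≡ 2
  |v|≡2 = trans (sum-cong-≗ (λ x → sym (*-identityʳ (𝟙 (incidentᵇ x v))))) (∑-incident i<j (λ _ → 1))
  |avoid|≡n∸2 : ∑[ x < n ] 𝟙 (avoid x) ≡ n ∸ 2
  |avoid|≡n∸2 = begin
    ∑[ x < n ] 𝟙 (avoid x)                                         ≡⟨ m+n∸n≡m _ 2 ⟨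
    ∑[ x < n ] 𝟙 (avoid x) + 2 ∸ 2                                 ≡⟨ cong (λ m → ∑[ x < n ] 𝟙 (avoid x) + m ∸ 2) |v|≡2 ⟨
    ∑[ x < n ] 𝟙 (avoid x) + ∑[ x < n ] 𝟙 (incidentᵇ x v) ∸ 2      ≡⟨ cong (_∸ 2) (∑-complement (λ x → incidentᵇ x v)) ⟩
    n ∸ 2                                                          ∎

-- Small edge sets lie in a closed neighbourhood

deg : List (Pair n) → Fin n → ℕ
deg S x = count (incidentᵇ x) S

_⊆N[_] : List (Pair n) → Pair n → Set
S ⊆N[ v ] = All (λ u → inClosedNbhᵇ v u ≡ true) S

deg≡0⇒∉ₑ : {S : List (Pair n)} {x : Fin n} {u : Pair n} → deg S x ≡ 0 → u ∈ S → ¬ x ∈ₑ u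
deg≡0⇒∉ₑ {u = u} deg≡0 u∈S x∈u with () ← trans (sym (∈ₑ⇒incidentᵇ u x∈u)) (count≡0⇒false _ deg≡0 u∈S)

deg≡1⇒∉ₑ : {S : List (Pair n)} {x : Fin n} {u e : Pair n} → Unique S → deg S x ≡ 1 →
  u ∈ S → e ∈ S → u ≢ e → x ∈ₑ e → ¬ x ∈ₑ u
deg≡1⇒∉ₑ {u = u} {e} uniq deg≡1 u∈S e∈S u≢e x∈e x∈u
  with s≤s () ← subst (2 ≤_) deg≡1
                  (2≤count _ uniq u∈S e∈S u≢e (∈ₑ⇒incidentᵇ u x∈u) (∈ₑ⇒incidentᵇ e x∈e))

⊆N[isolated-pair] : (S : List (Pair n)) {x y : Fin n} → deg S x ≡ 0 → deg S y ≡ 0 → S ⊆N[ (x , y) ]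
⊆N[isolated-pair] S x-isolated y-isolated = All.tabulate λ {u} u∈S →
  inClosedNbhᵇ-disjoint u (disjointᵇ-intro λ where
    z∈u (inj₁ refl) → deg≡0⇒∉ₑ x-isolated u∈S z∈u
    z∈u (inj₂ refl) → deg≡0⇒∉ₑ y-isolated u∈S z∈u)

IsolatedEdge : List (Pair n) → Pair n → Set
IsolatedEdge S (i , j) = deg S i ≡ 1 × deg S j ≡ 1

isolatedEdge? : (S : List (Pair n)) (e : Pair n) → Dec (IsolatedEdge S e)
isolatedEdge? S (i , j) = (deg S i ≟ 1) ×-dec (deg S j ≟ 1)

⊆N[isolated-edge] : (S : List (Pair n)) {e : Pair n} → Unique S → e ∈ S → IsolatedEdge S e → S ⊆N[ e ]
⊆N[isolated-edge] S {e@(i , j)} uniq e∈S (i-once , j-once) = All.tabulate λ {u} u∈S →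
  case-same-or-disjoint u u∈S (≡-dec F._≟_ F._≟_ u e)
  where
  case-same-or-disjoint : (u : Pair _) → u ∈ S → Dec (u ≡ e) → inClosedNbhᵇ e u ≡ true
  case-same-or-disjoint u _ (yes refl) = inClosedNbhᵇ-self e
  case-same-or-disjoint u u∈S (no u≢e) = inClosedNbhᵇ-disjoint u (disjointᵇ-intro λ where
    z∈u (inj₁ refl) → deg≡1⇒∉ₑ uniq i-once u∈S e∈S u≢e (inj₁ refl) z∈u
    z∈u (inj₂ refl) → deg≡1⇒∉ₑ uniq j-once u∈S e∈S u≢e (inj₂ refl) z∈u)

weighted-handshake : (f : Fin n → ℕ) (S : List (Pair n)) → All IsVertex S →
  ∑[ x < n ] (deg S x * f x) ≡ sum (map (λ e → f (proj₁ e) + f (proj₂ e)) S)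
weighted-handshake {n} f [] [] = sum-replicate-zero n
weighted-handshake {n} f ((i , j) ∷ S) (i<j ∷ S-vertices) = begin
  ∑[ x < n ] ((𝟙 (incidentᵇ x (i , j)) + deg S x) * f x)
    ≡⟨ sum-cong-≗ (λ x → *-distribʳ-+ (f x) (𝟙 (incidentᵇ x (i , j))) (deg S x)) ⟩
  ∑[ x < n ] (𝟙 (incidentᵇ x (i , j)) * f x + deg S x * f x)
    ≡⟨ ∑-distrib-+ (λ x → 𝟙 (incidentᵇ x (i , j)) * f x) (λ x → deg S x * f x) ⟩
  ∑[ x < n ] (𝟙 (incidentᵇ x (i , j)) * f x) + ∑[ x < n ] (deg S x * f x)
    ≡⟨ cong₂ _+_ (∑-incident i<j f) (weighted-handshake f S S-vertices) ⟩
  f i + f j + sum (map (λ e → f (proj₁ e) + f (proj₂ e)) S)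
    ∎
  where open ≡-Reasoning

-- A point of degree d charges weight d to each of its d edges, in total at least 2 when d > 0,
-- while an edge that is not isolated is charged at most 3; hence without isolated edges at most
-- 3|S|/2 points are covered.
weight : ℕ → ℕ
weight zero = 0
weight (suc zero) = 2
weight (suc (suc _)) = 1

2*𝟙[0<d]≤d*weight : (d : ℕ) → 2 * 𝟙 (0 <ᵇ d) ≤ d * weight d
2*𝟙[0<d]≤d*weight zero = z≤n
2*𝟙[0<d]≤d*weight (suc zero) = ≤-refl
2*𝟙[0<d]≤d*weight (suc (suc d)) = ≤-trans (s≤s (s≤s z≤n)) (≤-reflexive (sym (*-identityʳ (suc (suc d)))))

weight+weight≤3 : (a b : ℕ) → 1 ≤ a → 1 ≤ b → ¬ (a ≡ 1 × b ≡ 1) → weight a + weight b ≤ 3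
weight+weight≤3 (suc zero) (suc zero) _ _ not-both-1 = ⊥-elim (not-both-1 (refl , refl))
weight+weight≤3 (suc zero) (suc (suc _)) _ _ _ = ≤-refl
weight+weight≤3 (suc (suc _)) (suc zero) _ _ _ = ≤-refl
weight+weight≤3 (suc (suc _)) (suc (suc _)) _ _ _ = s≤s (s≤s z≤n)

covered-≤ : (S : List (Pair n)) → All IsVertex S → All (λ e → ¬ IsolatedEdge S e) S →
  2 * ∑[ x < n ] 𝟙 (0 <ᵇ deg S x) ≤ 3 * length S
covered-≤ {n} S S-vertices no-isolated-edge = begin
  2 * ∑[ x < n ] 𝟙 (0 <ᵇ deg S x)              ≡⟨ *-distribˡ-sum 2 (λ x → 𝟙 (0 <ᵇ deg S x)) ⟩
  ∑[ x < n ] (2 * 𝟙 (0 <ᵇ deg S x))            ≤⟨ ∑-mono-≤ (λ x → 2*𝟙[0<d]≤d*weight (deg S x)) ⟩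
  ∑[ x < n ] (deg S x * W x)                   ≡⟨ weighted-handshake W S S-vertices ⟩
  sum (map (λ e → W (proj₁ e) + W (proj₂ e)) S) ≤⟨ sum-map-≤ _ S (All.tabulate edge-weight≤3) ⟩
  3 * length S                                 ∎
  where
  open ≤-Reasoning
  W : Fin n → ℕ
  W x = weight (deg S x)
  edge-weight≤3 : {e : Pair n} → e ∈ S → W (proj₁ e) + W (proj₂ e) ≤ 3
  edge-weight≤3 {e@(i , j)} e∈S =
    weight+weight≤3 (deg S i) (deg S j) (1≤count _ e∈S (∈ₑ⇒incidentᵇ e (inj₁ refl)))
                    (1≤count _ e∈S (∈ₑ⇒incidentᵇ e (inj₂ refl))) (All.lookup no-isolated-edge e∈S)

∃-false⊎∑≡n : (p : Fin n → Bool) → (∃[ y ] p y ≡ false) ⊎ ∑[ x < n ] 𝟙 (p x) ≡ n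
∃-false⊎∑≡n {zero} p = inj₂ refl
∃-false⊎∑≡n {suc n} p with p zero in p0 | ∃-false⊎∑≡n (p ∘ suc)
... | false | _ = inj₁ (zero , p0)
... | true | inj₁ (y , py) = inj₁ (suc y , py)
... | true | inj₂ all-true = inj₂ (cong suc all-true)

∃₂-false⊎n≤1+∑ : (p : Fin n → Bool) →
  (∃[ x ] ∃[ y ] x F.< y × p x ≡ false × p y ≡ false) ⊎ n ≤ suc (∑[ x < n ] 𝟙 (p x))
∃₂-false⊎n≤1+∑ {zero} p = inj₂ z≤n
∃₂-false⊎n≤1+∑ {suc n} p with p zero in p0
... | false with ∃-false⊎∑≡n (p ∘ suc)
...   | inj₁ (y , py) = inj₁ (zero , suc y , s≤s z≤n , p0 , py)
...   | inj₂ all-true = inj₂ (s≤s (≤-reflexive (sym all-true)))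
∃₂-false⊎n≤1+∑ {suc n} p | true with ∃₂-false⊎n≤1+∑ (p ∘ suc)
...   | inj₁ (x , y , x<y , px , py) = inj₁ (suc x , suc y , s≤s x<y , px , py)
...   | inj₂ n≤1+∑ = inj₂ (s≤s n≤1+∑)

-- v is a pair of points missed by S or an isolated edge of S; if neither exists, covered-≤ gives 2n ≤ 3|S| + 2.
∃-⊆N : (S : List (Pair n)) → All IsVertex S → Unique S → 3 * length S + 3 ≤ 2 * n →
  ∃[ v ] IsVertex v × S ⊆N[ v ]
∃-⊆N {n} S S-vertices S-unique small with ∃₂-false⊎n≤1+∑ (λ x → 0 <ᵇ deg S x)
... | inj₁ (x , y , x<y , x-uncovered , y-uncovered) =
  (x , y) , x<y , ⊆N[isolated-pair] S (uncovered x-uncovered) (uncovered y-uncovered)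
  where
  uncovered : {d : ℕ} → (0 <ᵇ d) ≡ false → d ≡ 0
  uncovered {zero} _ = refl
... | inj₂ n≤1+covered with any? (isolatedEdge? S) S
...   | yes has-isolated =
  let e , e∈S , e-isolated = find has-isolated
  in e , All.lookup S-vertices e∈S , ⊆N[isolated-edge] S S-unique e∈S e-isolated
...   | no no-isolated = ⊥-elim (<-irrefl refl (≤-trans too-small small))
  where
  too-small : 2 * n < 3 * length S + 3
  too-small = begin-strict
    2 * n                                 ≤⟨ *-monoʳ-≤ 2 n≤1+covered ⟩
    2 * suc (∑[ x < n ] 𝟙 (0 <ᵇ deg S x))  ≡⟨ *-suc 2 _ ⟩
    2 + 2 * ∑[ x < n ] 𝟙 (0 <ᵇ deg S x)    ≤⟨ +-monoʳ-≤ 2 (covered-≤ S S-vertices (AllP.¬Any⇒All¬ S no-isolated)) ⟩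
    2 + 3 * length S                      <⟨ ≤-refl ⟩
    3 + 3 * length S                      ≡⟨ +-comm 3 (3 * length S) ⟩
    3 * length S + 3                      ∎
    where open ≤-Reasoning

-- Bounds on the k-tuple domination number

drop-isKTupleDominating : (r k : ℕ) → (∀ v → IsVertex v → k + r ≤ count (inClosedNbhᵇ v) (vertices n)) →
  IsKTupleDominating n k (drop r (vertices n))
drop-isKTupleDominating {n} r k large-nbh =
  (AllP.drop⁺ r (vertices-IsVertex n) , UniqueP.drop⁺ r (vertices-unique n)) , dominated
  where
  dominated : (v : Pair n) → IsVertex v → k ≤ closedNbhCount v (drop r (vertices n))
  dominated v v-vertex = +-cancelˡ-≤ r _ _ (begin
    r + k                                                   ≡⟨ +-comm r k ⟩
    k + r                                                   ≤⟨ large-nbh v v-vertex ⟩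
    count (inClosedNbhᵇ v) (vertices n)                     ≤⟨ count-≤-drop _ r (vertices n) ⟩
    r + count (inClosedNbhᵇ v) (drop r (vertices n))        ≡⟨ cong (r +_) (length-filterᵇ _ (drop r (vertices n))) ⟨
    r + closedNbhCount v (drop r (vertices n))              ∎)
    where open ≤-Reasoning

-- If D missed s + 1 vertices, some closed neighbourhood N[v] would contain all of them (∃-⊆N),
-- leaving fewer than k vertices of D in N[v].
length-vertices-≤ : (k s : ℕ) → 3 * suc s + 3 ≤ 2 * n →
  (∀ v → IsVertex v → count (inClosedNbhᵇ v) (vertices n) ≤ k + s) →
  (D : List (Pair n)) → IsKTupleDominating n k D → length (vertices n) ≤ length D + s
length-vertices-≤ {n} k s small small-nbh D ((D-vertices , D-unique) , dominated)
  with length (vertices n) ≤? length D + s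
... | yes enough = enough
... | no too-few = ⊥-elim (<-irrefl refl (begin-strict
    k + s                                             <⟨ ≤-reflexive (sym (+-suc k s)) ⟩
    k + suc s                                         ≤⟨ +-monoˡ-≤ (suc s) k≤|N[v]∩D| ⟩
    count (inClosedNbhᵇ v) D + suc s                  ≡⟨ cong (count (inClosedNbhᵇ v) D +_) |S|≡1+s ⟨
    count (inClosedNbhᵇ v) D + length S               ≤⟨ count+length-≤ _ D-unique S-unique D∩S=∅ D⊆V S⊆V S⊆N[v] ⟩
    count (inClosedNbhᵇ v) (vertices n)               ≤⟨ small-nbh v v-vertex ⟩
    k + s                                             ∎))
  where
  open ≤-Reasoning
  open DecMembership (≡-dec F._≟_ F._≟_) using (_∉?_)
  missing : List (Pair n)
  missing = filter (_∉? D) (vertices n)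
  1+s≤|missing| : suc s ≤ length missing
  1+s≤|missing| = +-cancelˡ-≤ (length D) _ _ (begin
    length D + suc s          ≡⟨ +-suc (length D) s ⟩
    suc (length D + s)        ≤⟨ ≰⇒> too-few ⟩
    length (vertices n)       ≤⟨ length-≤-+-complement (≡-dec F._≟_ F._≟_) D (vertices-unique n) ⟩
    length D + length missing ∎)
  S : List (Pair n)
  S = take (suc s) missing
  |S|≡1+s : length S ≡ suc s
  |S|≡1+s = trans (length-take (suc s) missing) (m≤n⇒m⊓n≡m 1+s≤|missing|)
  S⊆missing : S ⊆ missing
  S⊆missing = take-⊆ (suc s) missing
  S⊆V : S ⊆ vertices n
  S⊆V u∈S = proj₁ (∈-filter⁻ (_∉? D) {xs = vertices n} (S⊆missing u∈S))
  D⊆V : D ⊆ vertices n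
  D⊆V {u} u∈D = ∈-vertices u (All.lookup D-vertices u∈D)
  D∩S=∅ : Disjoint D S
  D∩S=∅ (u∈D , u∈S) = proj₂ (∈-filter⁻ (_∉? D) {xs = vertices n} (S⊆missing u∈S)) u∈D
  S-unique : Unique S
  S-unique = UniqueP.take⁺ (suc s) (UniqueP.filter⁺ (_∉? D) (vertices-unique n))
  S-vertices : All IsVertex S
  S-vertices = All.tabulate (λ u∈S → All.lookup (vertices-IsVertex n) (S⊆V u∈S))
  N[v]⊇S : ∃[ v ] IsVertex v × S ⊆N[ v ]
  N[v]⊇S = ∃-⊆N S S-vertices S-unique (subst (λ m → 3 * m + 3 ≤ 2 * n) (sym |S|≡1+s) small)
  v = proj₁ N[v]⊇S
  v-vertex = proj₁ (proj₂ N[v]⊇S)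
  S⊆N[v] = proj₂ (proj₂ N[v]⊇S)
  k≤|N[v]∩D| : k ≤ count (inClosedNbhᵇ v) D
  k≤|N[v]∩D| = subst (k ≤_) (length-filterᵇ _ D) (dominated v v-vertex)

2*⌈m/2⌉≤1+m : (m : ℕ) → 2 * ⌈ m /2⌉ ≤ suc m
2*⌈m/2⌉≤1+m zero = z≤n
2*⌈m/2⌉≤1+m (suc zero) = ≤-refl
2*⌈m/2⌉≤1+m (suc (suc m)) = ≤-trans (≤-reflexive (*-suc 2 ⌈ m /2⌉)) (s≤s (s≤s (2*⌈m/2⌉≤1+m m)))

bound⇒3[2+t]+3≤2n : (t n : ℕ) → 2 * (t + 3) ∸ ⌈ (t + 2) /2⌉ ≤ n → 3 * (2 + t) + 3 ≤ 2 * n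
bound⇒3[2+t]+3≤2n t n bound = +-cancelʳ-≤ (t + 3) _ _ (begin
  3 * (2 + t) + 3 + (t + 3)  ≡⟨ lhs-form t ⟩
  2 * (2 * (t + 3))          ≤⟨ *-monoʳ-≤ 2 (≤-trans (m≤n+m∸n _ c) (+-monoʳ-≤ c bound)) ⟩
  2 * (c + n)                ≡⟨ *-distribˡ-+ 2 c n ⟩
  2 * c + 2 * n              ≤⟨ +-monoˡ-≤ (2 * n) (2*⌈m/2⌉≤1+m (t + 2)) ⟩
  suc (t + 2) + 2 * n        ≡⟨ rhs-form t n ⟩
  2 * n + (t + 3)            ∎)
  where
  open ≤-Reasoning
  c = ⌈ (t + 2) /2⌉
  lhs-form : ∀ t → 3 * (2 + t) + 3 + (t + 3) ≡ 2 * (2 * (t + 3))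
  lhs-form = solve-∀
  rhs-form : ∀ t n → suc (t + 2) + 2 * n ≡ 2 * n + (t + 3)
  rhs-form = solve-∀

nC2≡[k+2n∸4]+[1+t] : {n : ℕ} (k t : ℕ) → 2 ≤ n → k + t ≡ (n ∸ 2) C 2 → n C 2 ≡ (k + 2 * n ∸ 4) + suc t
nC2≡[k+2n∸4]+[1+t] {suc (suc m)} k t (s≤s (s≤s z≤n)) k+t≡ = begin
  suc (suc m) C 2              ≡⟨ C2-suc (suc m) ⟩
  suc m + suc m C 2            ≡⟨ cong (suc m +_) (C2-suc m) ⟩
  suc m + (m + m C 2)          ≡⟨ cong (λ x → suc m + (m + x)) k+t≡ ⟨
  suc m + (m + (k + t))        ≡⟨ regroup k t m ⟩
  k + 2 * m + suc t            ≡⟨ cong (_+ suc t) (m+n∸n≡m (k + 2 * m) 4) ⟨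
  k + 2 * m + 4 ∸ 4 + suc t    ≡⟨ cong (λ x → x ∸ 4 + suc t) (add-4 k m) ⟩
  k + 2 * suc (suc m) ∸ 4 + suc t ∎
  where
  open ≡-Reasoning
  regroup : ∀ k t m → suc m + (m + (k + t)) ≡ k + 2 * m + suc t
  regroup = solve-∀
  add-4 : ∀ k m → k + 2 * m + 4 ≡ k + 2 * suc (suc m)
  add-4 = solve-∀

corollary30 : (t n : ℕ) → 5 ≤ n → 2 * (t + 3) ∸ ⌈ (t + 2) /2⌉ ≤ n →
    (k : ℕ) → k + t ≡ (n ∸ 2) C 2 →
    KTupleDominationNumber n k (k + 2 * n ∸ 4)
corollary30 t n 5≤n bound k k+t≡ = (D₀ , D₀-dominating , |D₀|) , minimal
  where
  |V| : length (vertices n) ≡ (k + 2 * n ∸ 4) + suc t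
  |V| = trans (length-vertices n) (nC2≡[k+2n∸4]+[1+t] k t (≤-trans (s≤s (s≤s z≤n)) 5≤n) k+t≡)
  |N[v]| : ∀ v → IsVertex v → count (inClosedNbhᵇ v) (vertices n) ≡ k + suc t
  |N[v]| v v-vertex = trans (closedNbh-size v v-vertex) (trans (cong suc (sym k+t≡)) (sym (+-suc k t)))
  D₀ : List (Pair n)
  D₀ = drop (suc t) (vertices n)
  D₀-dominating : IsKTupleDominating n k D₀
  D₀-dominating = drop-isKTupleDominating (suc t) k (λ v v-vertex → ≤-reflexive (sym (|N[v]| v v-vertex)))
  |D₀| : length D₀ ≡ k + 2 * n ∸ 4
  |D₀| = trans (length-drop (suc t) (vertices n)) (trans (cong (_∸ suc t) |V|) (m+n∸n≡m _ (suc t)))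
  minimal : (D : List (Pair n)) → IsKTupleDominating n k D → k + 2 * n ∸ 4 ≤ length D
  minimal D D-dominating = +-cancelʳ-≤ (suc t) _ _ (subst (_≤ length D + suc t) |V|
    (length-vertices-≤ k (suc t) (bound⇒3[2+t]+3≤2n t n bound) (λ v v-vertex → ≤-reflexive (|N[v]| v v-vertex))
                       D D-dominating))
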